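{- Let $h,p,k$ be positive integers with $1\le p\le h$ and $k\ge 2$, and put $n=h+(k-1)p$. Let $X'$ be the $(k-1)p\times h$ matrix in block form $X'=\begin{pmatrix}-J_{(k-1)p,\,h-p}& J_{(k-1)p,\,p}\end{pmatrix}$. Let $K_h=J_h-I_h$ be the adjacency matrix of the complete graph on $h$ vertices, let $\lambda$ be a scalar, and for integers $m\ge1$ put $C_p(m)=(1-\lambda)^{m-1}(1-m-\lambda)$. Then $$X'\cdot\operatorname{adj}(-K_h-\lambda I_h)\cdot X'^{T}=\Big(\big(C_p(h-1)-(1-\lambda)^{h-2}\big)h+(2p-h)^2(1-\lambda)^{h-2}\Big)J_{n-h}.$$
   Context: $J_{a,b}$ denotes the $a\times b$ all-ones matrix, $J_m=J_{m,m}$, $I_m$ the identity matrix of order $m$, and $\operatorname{adj}$ the adjugate matrix. Here $n=h+(k-1)p$ is the order of the graph formed by $k$ cliques of order $h$ sharing $h-p$ common vertices, so $n-h=(k-1)p$. -}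

module Defs where

open import Level using (Level)
open import Algebra.Bundles using (CommutativeRing)
open import Data.Nat as ℕ using (ℕ; zero; suc; _<ᵇ_; _∸_)
open import Data.Fin using (Fin; zero; suc; toℕ; punchIn)
open import Data.Bool using (if_then_else_)
import Data.Fin
import Relation.Nullary

module MatrixDefs {c ℓ : Level} (R : CommutativeRing c ℓ) where
  open CommutativeRing R hiding (zero)

  Matrix : ℕ → ℕ → Set c
  Matrix m n = Fin m → Fin n → Carrier

  Σ : {n : ℕ} → (Fin n → Carrier) → Carrier
  Σ {zero}  f = 0#
  Σ {suc n} f = f zero + Σ (λ i → f (suc i))

  fromℕ : ℕ → Carrier
  fromℕ zero    = 0#
  fromℕ (suc n) = 1# + fromℕ n

  pow : Carrier → ℕ → Carrier
  pow x zero    = 1#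
  pow x (suc n) = x * pow x n

  sgn : ℕ → Carrier
  sgn zero    = 1#
  sgn (suc k) = - sgn k

  J : (a b : ℕ) → Matrix a b
  J a b i j = 1#

  Jsq : (m : ℕ) → Matrix m m
  Jsq m = J m m

  Id : (m : ℕ) → Matrix m m
  Id m i j with Data.Fin._≟_ i j
  ... | Relation.Nullary.yes _ = 1#
  ... | Relation.Nullary.no  _ = 0#

  _⊕_ : {a b : ℕ} → Matrix a b → Matrix a b → Matrix a b
  (A ⊕ B) i j = A i j + B i j

  _⊖_ : {a b : ℕ} → Matrix a b → Matrix a b → Matrix a b
  (A ⊖ B) i j = A i j - B i j

  neg : {a b : ℕ} → Matrix a b → Matrix a b
  neg A i j = - A i j

  _·ₛ_ : {a b : ℕ} → Carrier → Matrix a b → Matrix a b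
  (x ·ₛ A) i j = x * A i j

  _⊗_ : {a b d : ℕ} → Matrix a b → Matrix b d → Matrix a d
  (A ⊗ B) i j = Σ (λ k → A i k * B k j)

  transpose : {a b : ℕ} → Matrix a b → Matrix b a
  transpose A i j = A j i

  minor : {n : ℕ} → Matrix (suc n) (suc n) → Fin (suc n) → Fin (suc n) → Matrix n n
  minor A i j a b = A (punchIn i a) (punchIn j b)

  det : {n : ℕ} → Matrix n n → Carrier
  det {zero}  A = 1#
  det {suc n} A = Σ (λ j → sgn (toℕ j) * (A zero j * det (minor A zero j)))

  adj : {n : ℕ} → Matrix n n → Matrix n n
  adj {zero}  A ()
  adj {suc n} A i j = sgn (toℕ i ℕ.+ toℕ j) * det (minor A j i)

  _≈ₘ_ : {a b : ℕ} → Matrix a b → Matrix a b → Set ℓ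
  A ≈ₘ B = ∀ i j → A i j ≈ B i j

  Kmat : (h : ℕ) → Matrix h h
  Kmat h = Jsq h ⊖ Id h

  X′ : (h p k : ℕ) → Matrix ((k ∸ 1) ℕ.* p) h
  X′ h p k i j = if toℕ j <ᵇ (h ∸ p) then - 1# else 1#

  C : Carrier → ℕ → Carrier
  C λ′ m = pow (1# - λ′) (m ∸ 1) * ((1# - fromℕ m) - λ′)

order : ℕ → ℕ → ℕ → ℕ
order h p k = h ℕ.+ (k ∸ 1) ℕ.* p

n-h : ℕ → ℕ → ℕ → ℕ
n-h h p k = (k ∸ 1) ℕ.* p

{-# OPTIONS --safe #-}
module Submission where

open import Defs
open import Algebra.Bundles using (CommutativeRing)
open import Algebra.Solver.Ring.AlmostCommutativeRing using (fromCommutativeRing; _-Raw-AlmostCommutative⟶_)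
open import Data.Bool using (true; false; if_then_else_)
open import Data.Empty using (⊥-elim)
open import Data.Fin as Fin using (Fin; zero; suc; toℕ; punchIn; punchOut)
import Data.Fin.Properties as Fin
open import Data.Integer as ℤ using (ℤ; +_; -[1+_]; _◃_; sign; ∣_∣)
import Data.Integer.Properties as ℤ
open import Data.Maybe using (Maybe; just; nothing)
open import Data.Nat as ℕ using (ℕ; zero; suc; _≤_; _∸_; z≤n; s≤s)
import Data.Nat.Properties as ℕ
open import Data.Sign as Sign using (Sign)
open import Function using (_∘_)
open import Relation.Binary.PropositionalEquality as ≡ using (_≡_; _≢_)
open import Relation.Nullary using (yes; no)

-- Write μ = 1 - λ, so that -K_h - λI = μI - J, whose adjugate is μ^(h-2) ((μ - h) I + J).
-- Expanding along the first row, det (μI - J) of order m is μ^(m-1) (μ - m) and every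
-- off-diagonal minor of order h - 1 is ±μ^(h-2).  The one further fact about determinants
-- needed is that a matrix with a row of ones and another constant row has determinant 0;
-- in the two-fold first-row expansion its terms cancel in pairs.  Every row of X′ is the
-- same sign vector x, with ⟨x, x⟩ = h and Σ x = 2p - h, so every entry of X′ adj X′ᵀ is
-- μ^(h-2) ((μ - h) h + (2p - h)²).

-- The ring solver needs a coefficient ring with a homomorphism into R; we use ℤ.
module Numerals {c ℓ} (R : CommutativeRing c ℓ) where
  open CommutativeRing R hiding (zero)
  open MatrixDefs R using (fromℕ)
  open import Algebra.Properties.Ring ring using (-‿distribʳ-*; -1*x≈-x; -‿involutive; -‿+-comm; -0#≈0#)
  open import Algebra.Properties.CommutativeSemigroup *-commutativeSemigroup using () renaming (interchange to *-interchange)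
  open import Relation.Binary.Reasoning.Setoid setoid

  fromℕ-+ : ∀ m n → fromℕ (m ℕ.+ n) ≈ fromℕ m + fromℕ n
  fromℕ-+ zero    n = sym (+-identityˡ _)
  fromℕ-+ (suc m) n = trans (+-congˡ (fromℕ-+ m n)) (sym (+-assoc _ _ _))

  fromℕ-* : ∀ m n → fromℕ (m ℕ.* n) ≈ fromℕ m * fromℕ n
  fromℕ-* zero    n = sym (zeroˡ _)
  fromℕ-* (suc m) n = begin
    fromℕ (n ℕ.+ m ℕ.* n)             ≈⟨ fromℕ-+ n (m ℕ.* n) ⟩
    fromℕ n + fromℕ (m ℕ.* n)         ≈⟨ +-cong (sym (*-identityˡ _)) (fromℕ-* m n) ⟩
    1# * fromℕ n + fromℕ m * fromℕ n  ≈⟨ distribʳ _ _ _ ⟨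
    (1# + fromℕ m) * fromℕ n          ∎

  [1+m]-[1+n]≈m-n : ∀ m n → fromℕ (suc m) - fromℕ (suc n) ≈ fromℕ m - fromℕ n
  [1+m]-[1+n]≈m-n m n = begin
    (1# + fromℕ m) + - (1# + fromℕ n)    ≈⟨ +-congˡ (-‿+-comm _ _) ⟨
    (1# + fromℕ m) + (- 1# + - fromℕ n)  ≈⟨ +-assoc _ _ _ ⟩
    1# + (fromℕ m + (- 1# + - fromℕ n))  ≈⟨ +-congˡ (trans (+-congˡ (+-comm _ _)) (sym (+-assoc _ _ _))) ⟩
    1# + ((fromℕ m - fromℕ n) + - 1#)    ≈⟨ +-congˡ (+-comm _ _) ⟩
    1# + (- 1# + (fromℕ m - fromℕ n))    ≈⟨ +-assoc _ _ _ ⟨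
    (1# - 1#) + (fromℕ m - fromℕ n)      ≈⟨ +-congʳ (-‿inverseʳ 1#) ⟩
    0# + (fromℕ m - fromℕ n)             ≈⟨ +-identityˡ _ ⟩
    fromℕ m - fromℕ n                    ∎

  fromℤ : ℤ → Carrier
  fromℤ (+ n)      = fromℕ n
  fromℤ -[1+ n ]   = - fromℕ (suc n)

  fromℤ-⊖ : ∀ m n → fromℤ (m ℤ.⊖ n) ≈ fromℕ m - fromℕ n
  fromℤ-⊖ m       zero    = trans (sym (+-identityʳ _)) (+-congˡ (sym -0#≈0#))
  fromℤ-⊖ zero    (suc n) = sym (+-identityˡ _)
  fromℤ-⊖ (suc m) (suc n) = begin
    fromℤ (suc m ℤ.⊖ suc n)      ≡⟨ ≡.cong fromℤ (ℤ.[1+m]⊖[1+n]≡m⊖n m n) ⟩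
    fromℤ (m ℤ.⊖ n)              ≈⟨ fromℤ-⊖ m n ⟩
    fromℕ m - fromℕ n            ≈⟨ [1+m]-[1+n]≈m-n m n ⟨
    fromℕ (suc m) - fromℕ (suc n) ∎

  fromSign : Sign → Carrier
  fromSign Sign.+ = 1#
  fromSign Sign.- = - 1#

  fromSign-* : ∀ s t → fromSign (s Sign.* t) ≈ fromSign s * fromSign t
  fromSign-* Sign.+ t      = sym (*-identityˡ _)
  fromSign-* Sign.- Sign.+ = sym (*-identityʳ _)
  fromSign-* Sign.- Sign.- = begin
    1#           ≈⟨ -‿involutive _ ⟨
    - - 1#       ≈⟨ -‿cong (-1*x≈-x 1#) ⟨
    - (- 1# * 1#) ≈⟨ -‿distribʳ-* _ _ ⟩
    - 1# * - 1#  ∎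

  fromℤ-◃ : ∀ s n → fromℤ (s ◃ n) ≈ fromSign s * fromℕ n
  fromℤ-◃ Sign.+ zero    = sym (zeroʳ _)
  fromℤ-◃ Sign.- zero    = sym (zeroʳ _)
  fromℤ-◃ Sign.+ (suc n) = sym (*-identityˡ _)
  fromℤ-◃ Sign.- (suc n) = sym (-1*x≈-x _)

  fromℤ-signAbs : ∀ i → fromℤ i ≈ fromSign (sign i) * fromℕ ∣ i ∣
  fromℤ-signAbs (+ n)    = sym (*-identityˡ _)
  fromℤ-signAbs -[1+ n ] = sym (-1*x≈-x _)

  fromℤ-+ : ∀ i j → fromℤ (i ℤ.+ j) ≈ fromℤ i + fromℤ j
  fromℤ-+ (+ m)    (+ n)    = fromℕ-+ m n
  fromℤ-+ (+ m)    -[1+ n ] = fromℤ-⊖ m (suc n)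
  fromℤ-+ -[1+ m ] (+ n)    = trans (fromℤ-⊖ n (suc m)) (+-comm _ _)
  fromℤ-+ -[1+ m ] -[1+ n ] = begin
    - fromℕ (suc (suc (m ℕ.+ n)))       ≡⟨ ≡.cong (λ k → - fromℕ (suc k)) (ℕ.+-suc m n) ⟨
    - fromℕ (suc m ℕ.+ suc n)           ≈⟨ -‿cong (fromℕ-+ (suc m) (suc n)) ⟩
    - (fromℕ (suc m) + fromℕ (suc n))   ≈⟨ -‿+-comm _ _ ⟨
    - fromℕ (suc m) + - fromℕ (suc n)   ∎

  fromℤ-* : ∀ i j → fromℤ (i ℤ.* j) ≈ fromℤ i * fromℤ j
  fromℤ-* i j = begin
    fromℤ ((sign i Sign.* sign j) ◃ (∣ i ∣ ℕ.* ∣ j ∣))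
      ≈⟨ fromℤ-◃ (sign i Sign.* sign j) (∣ i ∣ ℕ.* ∣ j ∣) ⟩
    fromSign (sign i Sign.* sign j) * fromℕ (∣ i ∣ ℕ.* ∣ j ∣)
      ≈⟨ *-cong (fromSign-* (sign i) (sign j)) (fromℕ-* ∣ i ∣ ∣ j ∣) ⟩
    (fromSign (sign i) * fromSign (sign j)) * (fromℕ ∣ i ∣ * fromℕ ∣ j ∣)
      ≈⟨ *-interchange _ _ _ _ ⟩
    (fromSign (sign i) * fromℕ ∣ i ∣) * (fromSign (sign j) * fromℕ ∣ j ∣)
      ≈⟨ *-cong (fromℤ-signAbs i) (fromℤ-signAbs j) ⟨
    fromℤ i * fromℤ j ∎

  fromℤ-neg : ∀ i → fromℤ (ℤ.- i) ≈ - fromℤ i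
  fromℤ-neg -[1+ n ]    = sym (-‿involutive _)
  fromℤ-neg (+ zero)    = sym -0#≈0#
  fromℤ-neg (+ suc n)   = refl

  -- fromℕ and fromℤ up to ≈, but with 1 ↦ 1# definitionally, so that the
  -- constant 1 in solver goals is literally 1#.
  fromℕ′ : ℕ → Carrier
  fromℕ′ zero          = 0#
  fromℕ′ (suc zero)    = 1#
  fromℕ′ (suc (suc n)) = 1# + fromℕ′ (suc n)

  fromℕ′≈fromℕ : ∀ n → fromℕ′ n ≈ fromℕ n
  fromℕ′≈fromℕ zero          = refl
  fromℕ′≈fromℕ (suc zero)    = sym (+-identityʳ 1#)
  fromℕ′≈fromℕ (suc (suc n)) = +-congˡ (fromℕ′≈fromℕ (suc n))

  ⟦_⟧ : ℤ → Carrier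
  ⟦ + n ⟧      = fromℕ′ n
  ⟦ -[1+ n ] ⟧ = - fromℕ′ (suc n)

  ⟦⟧≈fromℤ : ∀ i → ⟦ i ⟧ ≈ fromℤ i
  ⟦⟧≈fromℤ (+ n)      = fromℕ′≈fromℕ n
  ⟦⟧≈fromℤ -[1+ n ]   = -‿cong (fromℕ′≈fromℕ (suc n))

  homomorphism : ℤ.+-*-rawRing -Raw-AlmostCommutative⟶ fromCommutativeRing R
  homomorphism = record
    { ⟦_⟧    = ⟦_⟧
    ; +-homo = λ i j → via (i ℤ.+ j) (fromℤ-+ i j) (+-cong (⟦⟧≈fromℤ i) (⟦⟧≈fromℤ j))
    ; *-homo = λ i j → via (i ℤ.* j) (fromℤ-* i j) (*-cong (⟦⟧≈fromℤ i) (⟦⟧≈fromℤ j))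
    ; -‿homo = λ i → via (ℤ.- i) (fromℤ-neg i) (-‿cong (⟦⟧≈fromℤ i))
    ; 0-homo = refl
    ; 1-homo = refl
    }
    where
    via : ∀ i {x y} → fromℤ i ≈ x → y ≈ x → ⟦ i ⟧ ≈ y
    via i p q = trans (⟦⟧≈fromℤ i) (trans p (sym q))

  _≟ᶜ_ : ∀ i j → Maybe (⟦ i ⟧ ≈ ⟦ j ⟧)
  i ≟ᶜ j with i ℤ.≟ j
  ... | yes ≡.refl = just refl
  ... | no _       = nothing

  open import Algebra.Solver.Ring ℤ.+-*-rawRing (fromCommutativeRing R) homomorphism _≟ᶜ_ public
    using (Polynomial; solve; _:=_; _:+_; _:*_; _:-_; :-_; con)

  :0 :1 : ∀ {n} → Polynomial n
  :0 = con (+ 0)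
  :1 = con (+ 1)

  fromℕ-∸ : ∀ {m n} → n ≤ m → fromℕ (m ∸ n) ≈ fromℕ m - fromℕ n
  fromℕ-∸ {m} {n} n≤m = begin
    fromℕ (m ∸ n)                        ≈⟨ solve 2 (λ x y → x := (x :+ y) :- y) refl (fromℕ (m ∸ n)) (fromℕ n) ⟩
    (fromℕ (m ∸ n) + fromℕ n) - fromℕ n  ≈⟨ +-congʳ (fromℕ-+ (m ∸ n) n) ⟨
    fromℕ (m ∸ n ℕ.+ n) - fromℕ n        ≡⟨ ≡.cong (λ k → fromℕ k - fromℕ n) (ℕ.m∸n+n≡m n≤m) ⟩
    fromℕ m - fromℕ n                    ∎

module Sums {c ℓ} (R : CommutativeRing c ℓ) where
  open CommutativeRing R hiding (zero)
  open MatrixDefs R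
  open Numerals R
  open import Algebra.Properties.Ring ring using (-‿+-comm; -0#≈0#)
  open import Algebra.Properties.CommutativeSemigroup +-commutativeSemigroup using (x∙yz≈y∙xz) renaming (interchange to +-interchange)
  open import Relation.Binary.Reasoning.Setoid setoid

  Σ-cong : ∀ {n} {f g : Fin n → Carrier} → (∀ i → f i ≈ g i) → Σ f ≈ Σ g
  Σ-cong {zero}  f≈g = refl
  Σ-cong {suc n} f≈g = +-cong (f≈g zero) (Σ-cong (f≈g ∘ suc))

  Σ-+ : ∀ {n} (f g : Fin n → Carrier) → Σ (λ i → f i + g i) ≈ Σ f + Σ g
  Σ-+ {zero}  f g = sym (+-identityˡ 0#)
  Σ-+ {suc n} f g = trans (+-congˡ (Σ-+ (f ∘ suc) (g ∘ suc))) (+-interchange _ _ _ _)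

  Σ-*ˡ : ∀ {n} x (f : Fin n → Carrier) → Σ (λ i → x * f i) ≈ x * Σ f
  Σ-*ˡ {zero}  x f = sym (zeroʳ x)
  Σ-*ˡ {suc n} x f = trans (+-congˡ (Σ-*ˡ x (f ∘ suc))) (sym (distribˡ _ _ _))

  Σ-neg : ∀ {n} (f : Fin n → Carrier) → Σ (λ i → - f i) ≈ - Σ f
  Σ-neg {zero}  f = sym -0#≈0#
  Σ-neg {suc n} f = trans (+-congˡ (Σ-neg (f ∘ suc))) (-‿+-comm _ _)

  Σ-zero : ∀ {n} {f : Fin n → Carrier} → (∀ i → f i ≈ 0#) → Σ f ≈ 0#
  Σ-zero {zero}  f≈0 = refl
  Σ-zero {suc n} f≈0 = trans (+-cong (f≈0 zero) (Σ-zero (f≈0 ∘ suc))) (+-identityˡ 0#)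

  Σ-const : ∀ {n} x → Σ {n} (λ _ → x) ≈ fromℕ n * x
  Σ-const {zero}  x = sym (zeroˡ x)
  Σ-const {suc n} x = trans (+-cong (sym (*-identityˡ x)) (Σ-const {n} x)) (sym (distribʳ _ _ _))

  Σ-punchIn : ∀ {n} (i : Fin (suc n)) (f : Fin (suc n) → Carrier) → Σ f ≈ f i + Σ (f ∘ punchIn i)
  Σ-punchIn         zero    f = refl
  Σ-punchIn {suc n} (suc i) f = trans (+-congˡ (Σ-punchIn i (f ∘ suc))) (x∙yz≈y∙xz _ _ _)

  Σ-single : ∀ {n} (i : Fin n) (f : Fin n → Carrier) → (∀ j → j ≢ i → f j ≈ 0#) → Σ f ≈ f i
  Σ-single {suc n} i f f≈0 = begin
    Σ f                      ≈⟨ Σ-punchIn i f ⟩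
    f i + Σ (f ∘ punchIn i)  ≈⟨ +-congˡ (Σ-zero (λ j → f≈0 (punchIn i j) (Fin.punchInᵢ≢i i j))) ⟩
    f i + 0#                 ≈⟨ +-identityʳ _ ⟩
    f i                      ∎

  Id-≡ : ∀ {n} {i j : Fin n} → i ≡ j → Id n i j ≈ 1#
  Id-≡ {i = i} {j} i≡j with i Fin.≟ j
  ... | yes _   = refl
  ... | no i≢j  = ⊥-elim (i≢j i≡j)

  Id-≢ : ∀ {n} {i j : Fin n} → i ≢ j → Id n i j ≈ 0#
  Id-≢ {i = i} {j} i≢j with i Fin.≟ j
  ... | yes i≡j = ⊥-elim (i≢j i≡j)
  ... | no _    = refl

  Id-reindex : ∀ {m n} (ι : Fin m → Fin n) → (∀ {i j} → ι i ≡ ι j → i ≡ j) →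
               ∀ i j → Id n (ι i) (ι j) ≈ Id m i j
  Id-reindex ι ι-inj i j with i Fin.≟ j
  ... | yes i≡j = Id-≡ (≡.cong ι i≡j)
  ... | no i≢j  = Id-≢ (i≢j ∘ ι-inj)

  Σ-Id : ∀ {n} (i : Fin n) (f : Fin n → Carrier) → Σ (λ j → Id n i j * f j) ≈ f i
  Σ-Id {n} i f = trans (Σ-single i (λ j → Id n i j * f j) (λ j j≢i → trans (*-congʳ (Id-≢ (j≢i ∘ ≡.sym))) (zeroˡ _)))
                   (trans (*-congʳ (Id-≡ {i = i} ≡.refl)) (*-identityˡ _))

  Σ-split₂ : ∀ {m n} (f : Fin (suc m) → Fin (suc n) → Carrier) →
    Σ (λ s → Σ (f s)) ≈ (Σ (f zero) + Σ (λ s → f (suc s) zero)) + Σ (λ s → Σ (λ d → f (suc s) (suc d)))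
  Σ-split₂ f = trans (+-congˡ (Σ-+ (λ s → f (suc s) zero) (λ s → Σ (λ d → f (suc s) (suc d))))) (sym (+-assoc _ _ _))

  Σ-threshold : ∀ n a (x y : Carrier) → a ≤ n →
    Σ {n} (λ i → if toℕ i ℕ.<ᵇ a then x else y) ≈ fromℕ a * x + fromℕ (n ∸ a) * y
  Σ-threshold zero    zero    x y _         = solve 2 (λ x y → :0 := :0 :* x :+ :0 :* y) refl x y
  Σ-threshold (suc n) zero    x y _         = trans (+-congˡ (Σ-const {n} y))
    (solve 3 (λ x y N → y :+ N :* y := :0 :* x :+ (:1 :+ N) :* y) refl x y (fromℕ n))
  Σ-threshold (suc n) (suc a) x y (s≤s a≤n) = trans (+-congˡ (Σ-threshold n a x y a≤n))
    (solve 4 (λ x y A B → x :+ (A :* x :+ B :* y) := (:1 :+ A) :* x :+ B :* y) refl x y (fromℕ a) (fromℕ (n ∸ a)))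

module Determinants {c ℓ} (R : CommutativeRing c ℓ) where
  open CommutativeRing R hiding (zero)
  open MatrixDefs R
  open Sums R
  open Numerals R
  open import Algebra.Properties.Ring ring using (-‿distribˡ-*; -‿involutive; -0#≈0#)
  open import Algebra.Properties.CommutativeSemigroup *-commutativeSemigroup using (x∙yz≈y∙xz)
  open import Relation.Binary.Reasoning.Setoid setoid

  sgn-+ : ∀ a b → sgn (a ℕ.+ b) ≈ sgn a * sgn b
  sgn-+ zero    b = sym (*-identityˡ _)
  sgn-+ (suc a) b = trans (-‿cong (sgn-+ a b)) (-‿distribˡ-* _ _)

  sgn-suc-* : ∀ a b → sgn (suc a) * sgn (suc b) ≈ sgn a * sgn b
  sgn-suc-* a b = solve 2 (λ x y → (:- x) :* (:- y) := x :* y) refl (sgn a) (sgn b)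

  sgn-suc-+-suc : ∀ a b → sgn (suc a ℕ.+ suc b) ≈ sgn (a ℕ.+ b)
  sgn-suc-+-suc a b = trans (-‿cong (reflexive (≡.cong sgn (ℕ.+-suc a b)))) (-‿involutive _)

  sgn-*-sgn : ∀ a → sgn a * sgn a ≈ 1#
  sgn-*-sgn zero    = *-identityˡ 1#
  sgn-*-sgn (suc a) = trans (sgn-suc-* a a) (sgn-*-sgn a)

  det-cong : ∀ {n} {A B : Matrix n n} → A ≈ₘ B → det A ≈ det B
  det-cong {zero}  A≈B = refl
  det-cong {suc n} A≈B = Σ-cong λ j →
    *-congˡ {sgn (toℕ j)} (*-cong (A≈B zero j) (det-cong {n} (λ a b → A≈B (suc a) (punchIn j b))))

  Extensional : ∀ {m n} → ((Fin m → Fin n) → Carrier) → Set ℓ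
  Extensional F = ∀ {g g′} → (∀ b → g b ≡ g′ b) → F g ≈ F g′

  det-columns-ext : ∀ {m n} (N : Matrix m n) → Extensional (λ g → det (λ a b → N a (g b)))
  det-columns-ext N g≗g′ = det-cong (λ a b → reflexive (≡.cong (N a) (g≗g′ b)))

  Extensional-lift : ∀ {m n} {F : (Fin (suc m) → Fin (suc n)) → Carrier} →
                     Extensional F → Extensional (λ g → F (Fin.lift 1 g))
  Extensional-lift F-ext g≗g′ = F-ext λ { zero → ≡.refl ; (suc b) → ≡.cong suc (g≗g′ b) }

  punchIn₂ : ∀ {n} → Fin (suc (suc n)) → Fin (suc n) → Fin n → Fin (suc (suc n))
  punchIn₂ s d b = punchIn s (punchIn d b)

  punchIn₂-suc : ∀ {n} (s : Fin (suc (suc n))) (d : Fin (suc n)) b →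
                 punchIn₂ (suc s) (suc d) b ≡ Fin.lift 1 (punchIn₂ s d) b
  punchIn₂-suc s d zero    = ≡.refl
  punchIn₂-suc s d (suc b) = ≡.refl

  Σ-sgn-punchIn₂-suc : ∀ {n} (G : Fin (suc (suc n)) → Fin (suc n) → (Fin (suc n) → Fin (suc (suc (suc n)))) → Carrier) →
    (∀ s d → Extensional (G s d)) →
    Σ (λ s → Σ (λ d → (sgn (suc (toℕ s)) * sgn (suc (toℕ d))) * G s d (punchIn₂ (suc s) (suc d))))
    ≈ Σ (λ s → Σ (λ d → (sgn (toℕ s) * sgn (toℕ d)) * G s d (Fin.lift 1 (punchIn₂ s d))))
  Σ-sgn-punchIn₂-suc G G-ext = Σ-cong λ s → Σ-cong λ d →
    *-cong (sgn-suc-* (toℕ s) (toℕ d)) (G-ext s d (punchIn₂-suc s d))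

  -- The deleted pair {a < b} arises from (s, d) = (a, b - 1) and from (b, a), with opposite
  -- signs.  The terms with s = 0 cancel those with d = 0; the rest is the same sum one size down.
  Σ-sgn-punchIn₂≈0 : ∀ n (F : (Fin n → Fin (suc (suc n))) → Carrier) → Extensional F →
    Σ (λ s → Σ (λ d → (sgn (toℕ s) * sgn (toℕ d)) * F (punchIn₂ s d))) ≈ 0#
  Σ-sgn-punchIn₂≈0 n F F-ext = begin
    Σ (λ s → Σ (λ d → (sgn (toℕ s) * sgn (toℕ d)) * F (punchIn₂ s d)))
      ≈⟨ Σ-split₂ (λ s d → (sgn (toℕ s) * sgn (toℕ d)) * F (punchIn₂ s d)) ⟩
    (Σ (λ d → (1# * sgn (toℕ d)) * edge d) + Σ (λ s → (- sgn (toℕ s) * 1#) * edge s)) + corner n F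
      ≈⟨ +-cong (trans (sym (Σ-+ (λ d → (1# * sgn (toℕ d)) * edge d) (λ s → (- sgn (toℕ s) * 1#) * edge s)))
                       (Σ-zero λ d → cancel (sgn (toℕ d)) (edge d)))
                (corner≈0 n F F-ext) ⟩
    0# + 0#
      ≈⟨ +-identityˡ 0# ⟩
    0# ∎
    where
    edge : Fin (suc n) → Carrier
    edge d = F (suc ∘ punchIn d)
    cancel : ∀ a x → (1# * a) * x + (- a * 1#) * x ≈ 0#
    cancel = solve 2 (λ a x → (:1 :* a) :* x :+ (:- a :* :1) :* x := :0) refl
    corner : ∀ n → ((Fin n → Fin (suc (suc n))) → Carrier) → Carrier
    corner n F = Σ (λ s → Σ (λ d → (sgn (suc (toℕ s)) * sgn (suc (toℕ d))) * F (punchIn₂ (suc s) (suc d))))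
    corner≈0 : ∀ n F → Extensional F → corner n F ≈ 0#
    corner≈0 zero    F F-ext = Σ-zero {1} λ _ → refl
    corner≈0 (suc n) F F-ext = trans (Σ-sgn-punchIn₂-suc (λ _ _ → F) (λ _ _ → F-ext))
      (Σ-sgn-punchIn₂≈0 n (λ g → F (Fin.lift 1 g)) (Extensional-lift F-ext))

  -- Under the same pairing, the point deleted first in one term is deleted second in the other.
  Σ-sgn-punchIn₂-swap : ∀ n (F : Fin (suc (suc n)) → (Fin n → Fin (suc (suc n))) → Carrier) →
    (∀ x → Extensional (F x)) →
    Σ (λ s → Σ (λ d → (sgn (toℕ s) * sgn (toℕ d)) * F (punchIn s d) (punchIn₂ s d)))
    ≈ - Σ (λ s → Σ (λ d → (sgn (toℕ s) * sgn (toℕ d)) * F s (punchIn₂ s d)))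
  Σ-sgn-punchIn₂-swap n F F-ext = begin
    Σ (λ s → Σ (λ d → (sgn (toℕ s) * sgn (toℕ d)) * F (punchIn s d) (punchIn₂ s d)))
      ≈⟨ Σ-split₂ (λ s d → (sgn (toℕ s) * sgn (toℕ d)) * F (punchIn s d) (punchIn₂ s d)) ⟩
    (Σ (λ d → (1# * sgn (toℕ d)) * below d) + Σ (λ s → (- sgn (toℕ s) * 1#) * onTop s)) + cornerˡ n F
      ≈⟨ +-cong (+-cong (trans (Σ-cong λ d → flip₁ (sgn (toℕ d)) (below d)) (Σ-neg (λ d → (- sgn (toℕ d) * 1#) * below d)))
                        (trans (Σ-cong λ s → flip₂ (sgn (toℕ s)) (onTop s)) (Σ-neg (λ s → (1# * sgn (toℕ s)) * onTop s))))
                (corners n F F-ext) ⟩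
    (- Σ (λ d → (- sgn (toℕ d) * 1#) * below d) + - Σ (λ s → (1# * sgn (toℕ s)) * onTop s)) + - cornerʳ n F
      ≈⟨ regroup _ _ _ ⟩
    - ((Σ (λ s → (1# * sgn (toℕ s)) * onTop s) + Σ (λ d → (- sgn (toℕ d) * 1#) * below d)) + cornerʳ n F)
      ≈⟨ -‿cong (Σ-split₂ (λ s d → (sgn (toℕ s) * sgn (toℕ d)) * F s (punchIn₂ s d))) ⟨
    - Σ (λ s → Σ (λ d → (sgn (toℕ s) * sgn (toℕ d)) * F s (punchIn₂ s d))) ∎
    where
    below onTop : Fin (suc n) → Carrier
    below d = F (suc d) (suc ∘ punchIn d)
    onTop s = F zero (suc ∘ punchIn s)
    flip₁ : ∀ a x → (1# * a) * x ≈ - ((- a * 1#) * x)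
    flip₁ = solve 2 (λ a x → (:1 :* a) :* x := :- ((:- a :* :1) :* x)) refl
    flip₂ : ∀ a x → (- a * 1#) * x ≈ - ((1# * a) * x)
    flip₂ = solve 2 (λ a x → (:- a :* :1) :* x := :- ((:1 :* a) :* x)) refl
    regroup : ∀ a b c → (- a + - b) + - c ≈ - ((b + a) + c)
    regroup = solve 3 (λ a b c → (:- a :+ :- b) :+ :- c := :- ((b :+ a) :+ c)) refl
    cornerˡ cornerʳ : ∀ n → (Fin (suc (suc n)) → (Fin n → Fin (suc (suc n))) → Carrier) → Carrier
    cornerˡ n F = Σ (λ s → Σ (λ d → (sgn (suc (toℕ s)) * sgn (suc (toℕ d))) * F (suc (punchIn s d)) (punchIn₂ (suc s) (suc d))))
    cornerʳ n F = Σ (λ s → Σ (λ d → (sgn (suc (toℕ s)) * sgn (suc (toℕ d))) * F (suc s) (punchIn₂ (suc s) (suc d))))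
    corners : ∀ n F → (∀ x → Extensional (F x)) → cornerˡ n F ≈ - cornerʳ n F
    corners zero    F F-ext = trans (Σ-zero {1} λ _ → refl) (trans (sym -0#≈0#) (-‿cong (sym (Σ-zero {1} λ _ → refl))))
    corners (suc n) F F-ext = begin
      cornerˡ (suc n) F
        ≈⟨ Σ-sgn-punchIn₂-suc (λ s d → F (suc (punchIn s d))) (λ s d → F-ext (suc (punchIn s d))) ⟩
      Σ (λ s → Σ (λ d → (sgn (toℕ s) * sgn (toℕ d)) * F (suc (punchIn s d)) (Fin.lift 1 (punchIn₂ s d))))
        ≈⟨ Σ-sgn-punchIn₂-swap n (λ y g → F (suc y) (Fin.lift 1 g)) (λ y → Extensional-lift (F-ext (suc y))) ⟩
      - Σ (λ s → Σ (λ d → (sgn (toℕ s) * sgn (toℕ d)) * F (suc s) (Fin.lift 1 (punchIn₂ s d))))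
        ≈⟨ -‿cong (Σ-sgn-punchIn₂-suc (λ s d → F (suc s)) (λ s d → F-ext (suc s))) ⟨
      - cornerʳ (suc n) F ∎

  -- The determinant of N with a row of ones added on top, expanded along that row.
  onesRowDet : ∀ {m} → Matrix m (suc m) → Carrier
  onesRowDet N = Σ (λ s → sgn (toℕ s) * det (λ a b → N a (punchIn s b)))

  onesRowDet-cong : ∀ {m} {N N′ : Matrix m (suc m)} → N ≈ₘ N′ → onesRowDet N ≈ onesRowDet N′
  onesRowDet-cong {m} N≈N′ = Σ-cong λ s → *-congˡ {sgn (toℕ s)} (det-cong {m} (λ a b → N≈N′ a (punchIn s b)))

  minor₂ : ∀ {m} → Matrix (suc m) (suc (suc m)) → Fin (suc (suc m)) → Fin (suc m) → Matrix m m
  minor₂ N s d a b = N (suc a) (punchIn₂ s d b)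

  onesRowDet-expand : ∀ {m} (N : Matrix (suc m) (suc (suc m))) →
    onesRowDet N ≈ Σ (λ s → Σ (λ d → (sgn (toℕ s) * sgn (toℕ d)) * (N zero (punchIn s d) * det (minor₂ N s d))))
  onesRowDet-expand N = Σ-cong λ s →
    trans (sym (Σ-*ˡ (sgn (toℕ s)) (λ d → sgn (toℕ d) * (N zero (punchIn s d) * det (minor₂ N s d)))))
          (Σ-cong λ d → sym (*-assoc (sgn (toℕ s)) (sgn (toℕ d)) (N zero (punchIn s d) * det (minor₂ N s d))))

  onesRowDet-constantRow : ∀ {m} (N : Matrix m (suc m)) (k : Fin m) {κ} → (∀ s → N k s ≈ κ) → onesRowDet N ≈ 0#
  onesRowDet-constantRow {suc m} N zero {κ} N0≈κ = begin
    onesRowDet N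
      ≈⟨ onesRowDet-expand N ⟩
    Σ (λ s → Σ (λ d → (sgn (toℕ s) * sgn (toℕ d)) * (N zero (punchIn s d) * det (minor₂ N s d))))
      ≈⟨ Σ-cong (λ s → Σ-cong λ d →
           *-congˡ {sgn (toℕ s) * sgn (toℕ d)} (*-congʳ {det (minor₂ N s d)} (N0≈κ (punchIn s d)))) ⟩
    Σ (λ s → Σ (λ d → (sgn (toℕ s) * sgn (toℕ d)) * (κ * det (minor₂ N s d))))
      ≈⟨ Σ-sgn-punchIn₂≈0 m (λ g → κ * det (λ a b → N (suc a) (g b)))
                            (λ g≗g′ → *-congˡ {κ} (det-columns-ext (N ∘ suc) g≗g′)) ⟩
    0# ∎
  onesRowDet-constantRow {suc m} N (suc k) Nk≈κ = begin
    onesRowDet N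
      ≈⟨ onesRowDet-expand N ⟩
    Σ (λ s → Σ (λ d → (sgn (toℕ s) * sgn (toℕ d)) * (N zero (punchIn s d) * det (minor₂ N s d))))
      ≈⟨ Σ-sgn-punchIn₂-swap m (λ x g → N zero x * det (λ a b → N (suc a) (g b)))
                               (λ x g≗g′ → *-congˡ {N zero x} (det-columns-ext (N ∘ suc) g≗g′)) ⟩
    - Σ (λ s → Σ (λ d → (sgn (toℕ s) * sgn (toℕ d)) * (N zero s * det (minor₂ N s d))))
      ≈⟨ -‿cong (Σ-zero column≈0) ⟩
    - 0#
      ≈⟨ -0#≈0# ⟩
    0# ∎
    where
    column≈0 : ∀ s → Σ (λ d → (sgn (toℕ s) * sgn (toℕ d)) * (N zero s * det (minor₂ N s d))) ≈ 0#
    column≈0 s = begin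
      Σ (λ d → (sgn (toℕ s) * sgn (toℕ d)) * (N zero s * det (minor₂ N s d)))
        ≈⟨ Σ-cong (λ d → solve 4 (λ a b x y → (a :* b) :* (x :* y) := (a :* x) :* (b :* y)) refl
                                 (sgn (toℕ s)) (sgn (toℕ d)) (N zero s) (det (minor₂ N s d))) ⟩
      Σ (λ d → (sgn (toℕ s) * N zero s) * (sgn (toℕ d) * det (minor₂ N s d)))
        ≈⟨ Σ-*ˡ (sgn (toℕ s) * N zero s) (λ d → sgn (toℕ d) * det (minor₂ N s d)) ⟩
      (sgn (toℕ s) * N zero s) * onesRowDet (λ a b → N (suc a) (punchIn s b))
        ≈⟨ *-congˡ (onesRowDet-constantRow (λ a b → N (suc a) (punchIn s b)) k (Nk≈κ ∘ punchIn s)) ⟩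
      (sgn (toℕ s) * N zero s) * 0#
        ≈⟨ zeroʳ _ ⟩
      0# ∎

  det-constantFirstRow : ∀ {m} (M : Matrix (suc m) (suc m)) {κ} → (∀ s → M zero s ≈ κ) →
                         det M ≈ κ * onesRowDet (M ∘ suc)
  det-constantFirstRow M {κ} M0≈κ = begin
    Σ (λ s → sgn (toℕ s) * (M zero s * det (minor M zero s)))
      ≈⟨ Σ-cong (λ s → trans (*-congˡ {sgn (toℕ s)} (*-congʳ (M0≈κ s))) (x∙yz≈y∙xz (sgn (toℕ s)) κ (det (minor M zero s)))) ⟩
    Σ (λ s → κ * (sgn (toℕ s) * det (minor M zero s)))
      ≈⟨ Σ-*ˡ κ (λ s → sgn (toℕ s) * det (minor M zero s)) ⟩
    κ * onesRowDet (M ∘ suc) ∎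

  det-pivotFirstRow : ∀ {m} (M : Matrix (suc m) (suc m)) (t : Fin (suc m)) {μ} →
    (∀ s → M zero s ≈ μ * Id (suc m) t s - 1#) →
    det M ≈ μ * (sgn (toℕ t) * det (minor M zero t)) - onesRowDet (M ∘ suc)
  det-pivotFirstRow {m} M t {μ} M0≈ = begin
    Σ (λ s → sgn (toℕ s) * (M zero s * det (minor M zero s)))
      ≈⟨ Σ-cong (λ s → trans (*-congˡ {sgn (toℕ s)} (*-congʳ (M0≈ s)))
                             (split μ (sgn (toℕ s)) (Id (suc m) t s) (det (minor M zero s)))) ⟩
    Σ (λ s → μ * (Id (suc m) t s * cofactor s) - cofactor s)
      ≈⟨ Σ-+ (λ s → μ * (Id (suc m) t s * cofactor s)) (λ s → - cofactor s) ⟩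
    Σ (λ s → μ * (Id (suc m) t s * cofactor s)) + Σ (λ s → - cofactor s)
      ≈⟨ +-cong (trans (Σ-*ˡ μ (λ s → Id (suc m) t s * cofactor s)) (*-congˡ (Σ-Id t cofactor))) (Σ-neg cofactor) ⟩
    μ * cofactor t - onesRowDet (M ∘ suc) ∎
    where
    cofactor : Fin (suc m) → Carrier
    cofactor s = sgn (toℕ s) * det (minor M zero s)
    split : ∀ u a i d → a * ((u * i - 1#) * d) ≈ u * (i * (a * d)) - a * d
    split = solve 4 (λ u a i d → a :* ((u :* i :- :1) :* d) := u :* (i :* (a :* d)) :- a :* d) refl

  det-pivotFirstRow-constantRow : ∀ {m} (M : Matrix (suc m) (suc m)) (t : Fin (suc m)) (k : Fin m) {μ κ} →
    (∀ s → M zero s ≈ μ * Id (suc m) t s - 1#) → (∀ s → M (suc k) s ≈ κ) →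
    det M ≈ μ * (sgn (toℕ t) * det (minor M zero t))
  det-pivotFirstRow-constantRow M t k {μ} M0≈ Mk≈κ = begin
    det M                     ≈⟨ det-pivotFirstRow M t M0≈ ⟩
    pivot - onesRowDet (M ∘ suc) ≈⟨ +-congˡ (-‿cong (onesRowDet-constantRow (M ∘ suc) k Mk≈κ)) ⟩
    pivot - 0#                ≈⟨ trans (+-congˡ -0#≈0#) (+-identityʳ pivot) ⟩
    pivot                     ∎
    where
    pivot = μ * (sgn (toℕ t) * det (minor M zero t))

module CompleteGraph {c ℓ} (R : CommutativeRing c ℓ) (λ′ : CommutativeRing.Carrier R) where
  open CommutativeRing R hiding (zero)
  open MatrixDefs R
  open Sums R
  open Determinants R
  open Numerals R
  open import Algebra.Properties.CommutativeSemigroup *-commutativeSemigroup using (x∙yz≈y∙xz)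
  open import Relation.Binary.Reasoning.Setoid setoid

  μ : Carrier
  μ = 1# - λ′

  A : (n : ℕ) → Matrix n n
  A n = neg (Kmat n) ⊖ (λ′ ·ₛ Id n)

  A-entry : ∀ {n} (x y : Fin n) → A n x y ≈ μ * Id n x y - 1#
  A-entry {n} x y = solve 2 (λ l i → :- (:1 :- i) :- l :* i := (:1 :- l) :* i :- :1) refl λ′ (Id n x y)

  A-≢ : ∀ {n} {x y : Fin n} → x ≢ y → A n x y ≈ - 1#
  A-≢ {x = x} {y} x≢y = trans (A-entry x y) (trans (+-congʳ (trans (*-congˡ (Id-≢ x≢y)) (zeroʳ μ))) (+-identityˡ _))

  A-punchIn : ∀ {n} (c : Fin (suc n)) x y → A (suc n) (punchIn c x) (punchIn c y) ≈ A n x y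
  A-punchIn c x y = begin
    A _ (punchIn c x) (punchIn c y)            ≈⟨ A-entry (punchIn c x) (punchIn c y) ⟩
    μ * Id _ (punchIn c x) (punchIn c y) - 1#  ≈⟨ +-congʳ (*-congˡ (Id-reindex (punchIn c) (Fin.punchIn-injective c _ _) x y)) ⟩
    μ * Id _ x y - 1#                          ≈⟨ A-entry x y ⟨
    A _ x y                                    ∎

  Δ : ℕ → Carrier
  Δ zero    = 1#
  Δ (suc m) = pow μ m * (μ - fromℕ (suc m))

  det-A : ∀ m → det (A m) ≈ Δ m
  det-minor-A-diagonal : ∀ m b → det (minor (A (suc m)) b b) ≈ Δ m
  onesRowDet-A : ∀ m b → onesRowDet (λ a → A (suc m) (punchIn b a)) ≈ sgn (toℕ b) * pow μ m
  det-minor-A : ∀ m b c → b ≢ c → det (minor (A (suc (suc m))) b c) ≈ sgn (toℕ b ℕ.+ toℕ c) * pow μ m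

  det-A zero    = refl
  det-A (suc m) = begin
    det (A (suc m))
      ≈⟨ det-pivotFirstRow (A (suc m)) zero (A-entry zero) ⟩
    μ * (1# * det (minor (A (suc m)) zero zero)) - onesRowDet (A (suc m) ∘ suc)
      ≈⟨ +-cong (*-congˡ (*-congˡ (det-minor-A-diagonal m zero))) (-‿cong (onesRowDet-A m zero)) ⟩
    μ * (1# * Δ m) - 1# * pow μ m
      ≈⟨ Δ-step m ⟩
    Δ (suc m) ∎
    where
    Δ-step : ∀ m → μ * (1# * Δ m) - 1# * pow μ m ≈ Δ (suc m)
    Δ-step zero    = solve 1 (λ u → u :* (:1 :* :1) :- :1 :* :1
                                    := :1 :* (u :- (:1 :+ :0))) refl μ
    Δ-step (suc m) = solve 3 (λ u p f → u :* (:1 :* (p :* (u :- f))) :- :1 :* (u :* p)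
                                      := (u :* p) :* (u :- (:1 :+ f))) refl μ (pow μ m) (fromℕ (suc m))

  det-minor-A-diagonal m b = trans (det-cong (A-punchIn b)) (det-A m)

  onesRowDet-A zero    zero = +-identityʳ _
  onesRowDet-A (suc m) b    = begin
    onesRowDet (λ a → A (suc (suc m)) (punchIn b a))
      ≈⟨ Σ-punchIn b (λ s → sgn (toℕ s) * det (minor (A (suc (suc m))) b s)) ⟩
    sgn (toℕ b) * det (minor (A (suc (suc m))) b b) + Σ (λ d → sgn (toℕ (punchIn b d)) * det (minor (A (suc (suc m))) b (punchIn b d)))
      ≈⟨ +-cong (*-congˡ {sgn (toℕ b)} (det-minor-A-diagonal (suc m) b))
                (trans (Σ-cong offDiagonal) (Σ-const {suc m} (sgn (toℕ b) * pow μ m))) ⟩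
    sgn (toℕ b) * Δ (suc m) + fromℕ (suc m) * (sgn (toℕ b) * pow μ m)
      ≈⟨ collect (sgn (toℕ b)) (pow μ m) μ (fromℕ (suc m)) ⟩
    sgn (toℕ b) * pow μ (suc m) ∎
    where
    collect : ∀ s p u f → s * (p * (u - f)) + f * (s * p) ≈ s * (u * p)
    collect = solve 4 (λ s p u f → s :* (p :* (u :- f)) :+ f :* (s :* p) := s :* (u :* p)) refl
    offDiagonal : ∀ d → sgn (toℕ (punchIn b d)) * det (minor (A (suc (suc m))) b (punchIn b d)) ≈ sgn (toℕ b) * pow μ m
    offDiagonal d = begin
      x * det (minor (A (suc (suc m))) b (punchIn b d))
        ≈⟨ *-congˡ (trans (det-minor-A m b (punchIn b d) (Fin.punchInᵢ≢i b d ∘ ≡.sym))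
                          (*-congʳ (sgn-+ (toℕ b) (toℕ (punchIn b d))))) ⟩
      x * ((sgn (toℕ b) * x) * pow μ m)
        ≈⟨ solve 3 (λ x s p → x :* ((s :* x) :* p) := (x :* x) :* (s :* p)) refl x (sgn (toℕ b)) (pow μ m) ⟩
      (x * x) * (sgn (toℕ b) * pow μ m)
        ≈⟨ trans (*-congʳ (sgn-*-sgn (toℕ (punchIn b d)))) (*-identityˡ _) ⟩
      sgn (toℕ b) * pow μ m ∎
      where x = sgn (toℕ (punchIn b d))

  det-minor-A m zero zero 0≢0 = ⊥-elim (0≢0 ≡.refl)
  det-minor-A m zero (suc zero) _ = begin
    det (minor (A (suc (suc m))) zero (suc zero))
      ≈⟨ det-constantFirstRow (minor (A (suc (suc m))) zero (suc zero)) (λ s → A-≢ (Fin.punchInᵢ≢i (suc zero) s ∘ ≡.sym)) ⟩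
    - 1# * onesRowDet (λ a s → A (suc (suc m)) (suc (suc a)) (punchIn (suc zero) s))
      ≈⟨ *-congˡ (onesRowDet-cong {m} (λ a → A-punchIn (suc zero) (suc a))) ⟩
    - 1# * onesRowDet (λ a → A (suc m) (punchIn zero a))
      ≈⟨ *-congˡ (trans (onesRowDet-A m zero) (*-identityˡ _)) ⟩
    - 1# * pow μ m ∎
  det-minor-A zero    zero (suc (suc ())) _
  det-minor-A (suc m) zero (suc (suc c)) _ = begin
    det M
      ≈⟨ det-pivotFirstRow-constantRow M (suc zero) c
           (λ s → trans (A-punchIn (suc (suc c)) (suc zero) s) (A-entry (suc zero) s))
           (λ s → A-≢ (Fin.punchInᵢ≢i (suc (suc c)) s ∘ ≡.sym)) ⟩
    μ * (- 1# * det (minor M zero (suc zero)))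
      ≈⟨ *-congˡ (*-congˡ (det-cong (λ a b → trans (reflexive (≡.cong (A (suc (suc (suc m))) (suc (suc a))) (punchIn-comm c b)))
                                                   (A-punchIn (suc zero) (suc a) (punchIn (suc c) b))))) ⟩
    μ * (- 1# * det (minor (A (suc (suc m))) zero (suc c)))
      ≈⟨ *-congˡ (*-congˡ (det-minor-A m zero (suc c) λ ())) ⟩
    μ * (- 1# * (- sgn (toℕ c) * pow μ m))
      ≈⟨ solve 3 (λ u s p → u :* (:- :1 :* (:- s :* p)) := (:- :- s) :* (u :* p)) refl μ (sgn (toℕ c)) (pow μ m) ⟩
    - - sgn (toℕ c) * (μ * pow μ m) ∎
    where
    M = minor (A (suc (suc (suc m)))) zero (suc (suc c))
    punchIn-comm : ∀ {n} (c b : Fin (suc n)) → punchIn (suc (suc c)) (punchIn (suc zero) b) ≡ punchIn (suc zero) (punchIn (suc c) b)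
    punchIn-comm c zero    = ≡.refl
    punchIn-comm c (suc b) = ≡.refl
  det-minor-A m (suc b) zero _ = begin
    det (minor (A (suc (suc m))) (suc b) zero)
      ≈⟨ det-constantFirstRow (minor (A (suc (suc m))) (suc b) zero) (λ s → A-≢ {x = zero} {y = suc s} λ ()) ⟩
    - 1# * onesRowDet (λ a s → A (suc (suc m)) (suc (punchIn b a)) (suc s))
      ≈⟨ *-congˡ (onesRowDet-cong {m} (λ a → A-punchIn zero (punchIn b a))) ⟩
    - 1# * onesRowDet (λ a → A (suc m) (punchIn b a))
      ≈⟨ *-congˡ (onesRowDet-A m b) ⟩
    - 1# * (sgn (toℕ b) * pow μ m)
      ≈⟨ solve 2 (λ s p → :- :1 :* (s :* p) := :- s :* p) refl (sgn (toℕ b)) (pow μ m) ⟩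
    - sgn (toℕ b) * pow μ m
      ≡⟨ ≡.cong (λ k → - sgn k * pow μ m) (ℕ.+-identityʳ (toℕ b)) ⟨
    - sgn (toℕ b ℕ.+ 0) * pow μ m ∎
  det-minor-A zero    (suc zero) (suc zero) 1≢1 = ⊥-elim (1≢1 ≡.refl)
  det-minor-A (suc m) (suc b) (suc c) 1+b≢1+c = begin
    det M
      ≈⟨ det-pivotFirstRow-constantRow M zero (punchOut b≢c)
           (λ s → trans (A-punchIn (suc c) zero s) (A-entry zero s))
           (λ s → A-≢ λ e → Fin.punchInᵢ≢i (suc c) s (≡.trans (≡.sym e) (≡.cong suc (Fin.punchIn-punchOut b≢c)))) ⟩
    μ * (1# * det (minor M zero zero))
      ≈⟨ *-congˡ (*-congˡ (det-cong (λ a → A-punchIn zero (punchIn b a) ∘ punchIn c))) ⟩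
    μ * (1# * det (minor (A (suc (suc m))) b c))
      ≈⟨ *-congˡ (*-congˡ (det-minor-A m b c b≢c)) ⟩
    μ * (1# * (sgn (toℕ b ℕ.+ toℕ c) * pow μ m))
      ≈⟨ solve 3 (λ u s p → u :* (:1 :* (s :* p)) := s :* (u :* p)) refl μ (sgn (toℕ b ℕ.+ toℕ c)) (pow μ m) ⟩
    sgn (toℕ b ℕ.+ toℕ c) * (μ * pow μ m)
      ≈⟨ *-congʳ (sgn-suc-+-suc (toℕ b) (toℕ c)) ⟨
    sgn (suc (toℕ b) ℕ.+ suc (toℕ c)) * pow μ (suc m) ∎
    where
    M = minor (A (suc (suc (suc m)))) (suc b) (suc c)
    b≢c : b ≢ c
    b≢c = 1+b≢1+c ∘ ≡.cong suc

  adj-A : ∀ n (k l : Fin (suc (suc n))) →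
          adj (A (suc (suc n))) k l ≈ pow μ n * (Id _ k l * (μ - fromℕ (suc (suc n))) + 1#)
  -- Matching on k ≟ l also reduces Id _ k l in the goal to 1# or 0#.
  adj-A n k l with k Fin.≟ l
  ... | yes ≡.refl = begin
    sgn (toℕ k ℕ.+ toℕ k) * det (minor (A (suc (suc n))) k k)
      ≈⟨ *-cong (trans (sgn-+ (toℕ k) (toℕ k)) (sgn-*-sgn (toℕ k))) (det-minor-A-diagonal (suc n) k) ⟩
    1# * (pow μ n * (μ - fromℕ (suc n)))
      ≈⟨ solve 3 (λ p u f → :1 :* (p :* (u :- f)) := p :* (:1 :* (u :- (:1 :+ f)) :+ :1)) refl (pow μ n) μ (fromℕ (suc n)) ⟩
    pow μ n * (1# * (μ - fromℕ (suc (suc n))) + 1#) ∎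
  ... | no k≢l = begin
    sgn (toℕ k ℕ.+ toℕ l) * det (minor (A (suc (suc n))) l k)
      ≈⟨ *-cong (sgn-+ (toℕ k) (toℕ l)) (trans (det-minor-A n l k (k≢l ∘ ≡.sym)) (*-congʳ (sgn-+ (toℕ l) (toℕ k)))) ⟩
    (sgn (toℕ k) * sgn (toℕ l)) * ((sgn (toℕ l) * sgn (toℕ k)) * pow μ n)
      ≈⟨ solve 3 (λ a b p → (a :* b) :* ((b :* a) :* p) := ((a :* a) :* (b :* b)) :* p) refl (sgn (toℕ k)) (sgn (toℕ l)) (pow μ n) ⟩
    ((sgn (toℕ k) * sgn (toℕ k)) * (sgn (toℕ l) * sgn (toℕ l))) * pow μ n
      ≈⟨ *-congʳ (*-cong (sgn-*-sgn (toℕ k)) (sgn-*-sgn (toℕ l))) ⟩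
    (1# * 1#) * pow μ n
      ≈⟨ solve 2 (λ p d → (:1 :* :1) :* p := p :* (:0 :* d :+ :1)) refl (pow μ n) (μ - fromℕ (suc (suc n))) ⟩
    pow μ n * (0# * (μ - fromℕ (suc (suc n))) + 1#) ∎

  adj-A-bilinear : ∀ n (x y : Fin (suc (suc n)) → Carrier) →
    Σ (λ k → x k * Σ (λ l → adj (A (suc (suc n))) k l * y l))
    ≈ pow μ n * ((μ - fromℕ (suc (suc n))) * Σ (λ k → x k * y k) + Σ x * Σ y)
  adj-A-bilinear n x y = begin
    Σ (λ k → x k * Σ (λ l → adj (A (suc (suc n))) k l * y l))
      ≈⟨ Σ-cong (λ k → *-congˡ {x k} (adj-A-row k)) ⟩
    Σ (λ k → x k * (a * y k + b))
      ≈⟨ Σ-cong (λ k → distribˡ (x k) (a * y k) b) ⟩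
    Σ (λ k → x k * (a * y k) + x k * b)
      ≈⟨ Σ-+ (λ k → x k * (a * y k)) (λ k → x k * b) ⟩
    Σ (λ k → x k * (a * y k)) + Σ (λ k → x k * b)
      ≈⟨ +-cong (trans (Σ-cong (λ k → x∙yz≈y∙xz (x k) a (y k))) (Σ-*ˡ a (λ k → x k * y k)))
                (trans (Σ-cong (λ k → *-comm (x k) b)) (Σ-*ˡ b x)) ⟩
    a * Σ (λ k → x k * y k) + b * Σ x
      ≈⟨ solve 5 (λ p d s X Y → (p :* d) :* s :+ (p :* Y) :* X := p :* (d :* s :+ X :* Y)) refl
                 (pow μ n) (μ - fromℕ (suc (suc n))) (Σ (λ k → x k * y k)) (Σ x) (Σ y) ⟩
    pow μ n * ((μ - fromℕ (suc (suc n))) * Σ (λ k → x k * y k) + Σ x * Σ y) ∎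
    where
    a = pow μ n * (μ - fromℕ (suc (suc n)))
    b = pow μ n * Σ y
    adj-A-row : ∀ k → Σ (λ l → adj (A (suc (suc n))) k l * y l) ≈ a * y k + b
    adj-A-row k = begin
      Σ (λ l → adj (A (suc (suc n))) k l * y l)
        ≈⟨ Σ-cong (λ l → trans (*-congʳ (adj-A n k l))
             (solve 4 (λ p d i y → (p :* (i :* d :+ :1)) :* y := (p :* d) :* (i :* y) :+ p :* y) refl
                      (pow μ n) (μ - fromℕ (suc (suc n))) (Id _ k l) (y l))) ⟩
      Σ (λ l → a * (Id _ k l * y l) + pow μ n * y l)
        ≈⟨ Σ-+ (λ l → a * (Id _ k l * y l)) (λ l → pow μ n * y l) ⟩
      Σ (λ l → a * (Id _ k l * y l)) + Σ (λ l → pow μ n * y l)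
        ≈⟨ +-cong (trans (Σ-*ˡ a (λ l → Id _ k l * y l)) (*-congˡ (Σ-Id k y))) (Σ-*ˡ (pow μ n) y) ⟩
      a * y k + b ∎

module SignVectors {c ℓ} (R : CommutativeRing c ℓ) where
  open CommutativeRing R hiding (zero)
  open MatrixDefs R
  open Sums R
  open Numerals R
  open import Relation.Binary.Reasoning.Setoid setoid

  signVector : (n a : ℕ) → Fin n → Carrier
  signVector n a k = if toℕ k ℕ.<ᵇ a then - 1# else 1#

  signVector-square : ∀ n a k → signVector n a k * signVector n a k ≈ 1#
  signVector-square n a k with toℕ k ℕ.<ᵇ a
  ... | true  = solve 0 (:- :1 :* :- :1 := :1) refl
  ... | false = *-identityˡ 1#

  Σ-signVector : ∀ n p → p ≤ n → Σ (signVector n (n ∸ p)) ≈ fromℕ 2 * fromℕ p - fromℕ n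
  Σ-signVector n p p≤n = begin
    Σ (signVector n (n ∸ p))
      ≈⟨ Σ-threshold n (n ∸ p) (- 1#) 1# (ℕ.m∸n≤m n p) ⟩
    fromℕ (n ∸ p) * - 1# + fromℕ (n ∸ (n ∸ p)) * 1#
      ≈⟨ +-cong (*-congʳ (fromℕ-∸ p≤n)) (*-congʳ (reflexive (≡.cong fromℕ (ℕ.m∸[m∸n]≡n p≤n)))) ⟩
    (fromℕ n - fromℕ p) * - 1# + fromℕ p * 1#
      ≈⟨ solve 2 (λ N P → (N :- P) :* :- :1 :+ P :* :1 := (:1 :+ (:1 :+ :0)) :* P :- N) refl (fromℕ n) (fromℕ p) ⟩
    fromℕ 2 * fromℕ p - fromℕ n ∎

lemma5 : ∀ {c ℓ} (R : CommutativeRing c ℓ) →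
    let open CommutativeRing R
        open MatrixDefs R
    in
    (h p k : ℕ) → 1 ≤ p → p ≤ h → 2 ≤ k → 2 ≤ h →
    (λ′ : Carrier) →
    (X′ h p k ⊗ (adj (neg (Kmat h) ⊖ (λ′ ·ₛ Id h)) ⊗ transpose (X′ h p k)))
      ≈ₘ
    ((((C λ′ (h ∸ 1) - pow (1# - λ′) (h ∸ 2)) * fromℕ h)
        + (pow ((fromℕ 2 * fromℕ p) - fromℕ h) 2 * pow (1# - λ′) (h ∸ 2)))
      ·ₛ Jsq (n-h h p k))
lemma5 R h@(suc (suc n)) p _ _ p≤h _ (s≤s (s≤s z≤n)) λ′ _ _ = begin
  Σ (λ k → x k * Σ (λ l → adj (A h) k l * x l))
    ≈⟨ adj-A-bilinear n x x ⟩
  pow μ n * ((μ - fromℕ h) * Σ (λ k → x k * x k) + Σ x * Σ x)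
    ≈⟨ *-congˡ (+-cong (*-congˡ (trans (Σ-cong (signVector-square h (h ∸ p))) (Σ-const {h} 1#)))
                       (*-cong (Σ-signVector h p p≤h) (Σ-signVector h p p≤h))) ⟩
  pow μ n * ((μ - fromℕ h) * (fromℕ h * 1#) + D * D)
    ≈⟨ solve 4 (λ P l N D → P :* (((:1 :- l) :- (:1 :+ (:1 :+ N))) :* ((:1 :+ (:1 :+ N)) :* :1) :+ D :* D)
                         := ((P :* ((:1 :- (:1 :+ N)) :- l) :- P) :* (:1 :+ (:1 :+ N)) :+ D :* (D :* :1) :* P) :* :1)
               refl (pow μ n) λ′ (fromℕ n) D ⟩
  (((C λ′ (h ∸ 1) - pow μ n) * fromℕ h) + (pow D 2 * pow μ n)) * 1# ∎
  where
  open CommutativeRing R hiding (zero)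
  open MatrixDefs R
  open Sums R
  open Numerals R
  open SignVectors R
  open CompleteGraph R λ′
  open import Relation.Binary.Reasoning.Setoid setoid
  x = signVector h (h ∸ p)
  D = fromℕ 2 * fromℕ p - fromℕ h
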